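{- Let $(G,\sigma)$ be a 2-edge-connected signed graph whose number of negative edges equals its negativeness, $|E^-(G,\sigma)|=\epsilon(G,\sigma)$, and let $G^+=G\setminus E^-(G,\sigma)$ (the spanning subgraph of positive edges). If $(G,\sigma)$ has a family of circuits $\mathcal F$ such that every negative edge is contained in a cycle of the graph $\bigcup_{C\in\mathcal F}C$, then every cutedge of $G^+$ belongs to some circuit in $\mathcal F$.
   Context: A signed graph $(G,\sigma)$ is a graph with $\sigma:E(G)\to\{ -1,+1\}$; $E^-(G,\sigma)=\{e:\sigma(e)=-1\}$. A cycle is a connected 2-regular subgraph; it is positive if it has an even number of negative edges, negative otherwise. A barbell is a pair of edge-disjoint negative cycles joined by a path (possibly of length zero); a circuit is a positive cycle or a barbell. An edge cut is a minimal set of edges whose removal disconnects the graph; switching at an edge cut $S$ multiplies the signs of edges in $S$ by $-1$, and signatures related by switching are equivalent. The negativeness $\epsilon(G,\sigma)$ is the minimum number of negative edges over all signatures equivalent to $\sigma$. A cutedge of a graph is an edge whose deletion increases the number of components. -}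

module Defs where

open import Data.Nat using (ℕ; zero; suc; _+_; _≤_; _%_)
open import Data.Bool using (Bool; true; false; if_then_else_)
open import Data.Fin using (Fin; _≟_)
open import Data.Fin.Subset using (Subset; _∈_; _∉_; _⊆_; _⊂_; _∪_; _∩_; _─_; _-_; ⊥; ⊤; ∣_∣; inside; outside)
open import Data.Vec using (Vec; lookup; tabulate)
open import Data.List using (List; map; allFin; foldr)
open import Data.Nat.ListAction using (sum)
open import Data.Product using (Σ; ∃; ∃-syntax; _×_; _,_; proj₁; proj₂)
open import Data.Sum using (_⊎_)
open import Relation.Nullary using (¬_; does)
open import Relation.Binary.PropositionalEquality using (_≡_; _≢_)

-- A finite multigraph (loops and parallel edges allowed) with vertex set
-- Fin n and edge set Fin m; each edge has two (unordered) ends.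
record Graph (n m : ℕ) : Set where
  field
    ends : Fin m → Fin n × Fin n

data Sign : Set where
  plus minus : Sign

Signature : ℕ → Set
Signature m = Fin m → Sign

flipSign : Sign → Sign
flipSign plus  = minus
flipSign minus = plus

isNeg : Sign → Bool
isNeg plus  = false
isNeg minus = true

negSet : ∀ {m} → Signature m → Subset m
negSet σ = tabulate (λ e → isNeg (σ e))

posSet : ∀ {m} → Signature m → Subset m
posSet σ = tabulate (λ e → if isNeg (σ e) then outside else inside)

module _ {n m : ℕ} (G : Graph n m) where
  open Graph G

  Joins : Fin m → Fin n → Fin n → Set
  Joins e u w = (proj₁ (ends e) ≡ u × proj₂ (ends e) ≡ w)
              ⊎ (proj₁ (ends e) ≡ w × proj₂ (ends e) ≡ u)

  Incident : Fin m → Fin n → Set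
  Incident e v = proj₁ (ends e) ≡ v ⊎ proj₂ (ends e) ≡ v

  VIn : Subset m → Fin n → Set
  VIn S v = ∃[ e ] (e ∈ S × Incident e v)

  data Reach (S : Subset m) : Fin n → Fin n → Set where
    here  : ∀ {v} → Reach S v v
    step  : ∀ {u w x} (e : Fin m) → e ∈ S → Joins e u w → Reach S w x → Reach S u x

  SpanConnected : Subset m → Set
  SpanConnected S = ∀ u v → Reach S u v

  EConnected : Subset m → Set
  EConnected S = ∀ u v → VIn S u → VIn S v → Reach S u v

  -- degree of v in the subgraph with edge set S (a loop counts twice)
  ind : Fin n → Fin n → ℕ
  ind a v = if does (a ≟ v) then 1 else 0

  deg : Subset m → Fin n → ℕ
  deg S v = sum (map (λ e → if lookup S e then ind (proj₁ (ends e)) v + ind (proj₂ (ends e)) v else 0) (allFin m))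

  IsCycle : Subset m → Set
  IsCycle C = (∃[ e ] e ∈ C) × EConnected C × (∀ v → deg C v ≡ 0 ⊎ deg C v ≡ 2)

  IsPath : Subset m → Fin n → Fin n → Set
  IsPath P u v = u ≢ v × EConnected P × deg P u ≡ 1 × deg P v ≡ 1
               × (∀ w → w ≢ u → w ≢ v → deg P w ≡ 0 ⊎ deg P w ≡ 2)

  negCount : Signature m → Subset m → ℕ
  negCount σ S = ∣ S ∩ negSet σ ∣

  PositiveCycle NegativeCycle : Signature m → Subset m → Set
  PositiveCycle σ C = IsCycle C × negCount σ C % 2 ≡ 0
  NegativeCycle σ C = IsCycle C × negCount σ C % 2 ≡ 1

  -- a barbell: two edge-disjoint negative cycles C₁, C₂ joined by a path P;
  -- either P has length zero and C₁, C₂ share exactly one vertex, or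
  -- C₁, C₂ are vertex-disjoint and P meets C₁ exactly in u and C₂ exactly in v.
  IsBarbell : Signature m → Subset m → Set
  IsBarbell σ B =
    Σ (Subset m) λ C₁ → Σ (Subset m) λ C₂ → Σ (Subset m) λ P →
      NegativeCycle σ C₁ × NegativeCycle σ C₂ × B ≡ (C₁ ∪ C₂) ∪ P ×
      ( (P ≡ ⊥ × C₁ ∩ C₂ ≡ ⊥ ×
           (∃[ x ] (VIn C₁ x × VIn C₂ x × (∀ y → VIn C₁ y → VIn C₂ y → y ≡ x))))
      ⊎ (∃[ u ] ∃[ v ] (IsPath P u v × VIn C₁ u × VIn C₂ v
           × (∀ y → VIn C₁ y → ¬ VIn C₂ y)
           × (∀ y → VIn P y → VIn C₁ y → y ≡ u)
           × (∀ y → VIn P y → VIn C₂ y → y ≡ v))))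

  IsCircuit : Signature m → Subset m → Set
  IsCircuit σ C = PositiveCycle σ C ⊎ IsBarbell σ C

  TwoEdgeConnected : Set
  TwoEdgeConnected = SpanConnected ⊤ × (∀ e → SpanConnected (⊤ - e))

  IsEdgeCut : Subset m → Set
  IsEdgeCut S = ¬ SpanConnected (⊤ ─ S) × (∀ T → T ⊂ S → SpanConnected (⊤ ─ T))

  switch : Signature m → Subset m → Signature m
  switch σ S e = if lookup S e then flipSign (σ e) else σ e

  data Equivalent : Signature m → Signature m → Set where
    same   : ∀ {σ τ} → (∀ e → σ e ≡ τ e) → Equivalent σ τ
    switchAt : ∀ {σ τ} (S : Subset m) → IsEdgeCut S → Equivalent (switch σ S) τ → Equivalent σ τ

  -- |E^-(G,σ)| = ε(G,σ): σ has the minimum number of negative edges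
  -- among all signatures equivalent to σ
  MinNegative : Signature m → Set
  MinNegative σ = ∀ τ → Equivalent σ τ → ∣ negSet σ ∣ ≤ ∣ negSet τ ∣

  IsCutedgeOf : Subset m → Fin m → Set
  IsCutedgeOf S e = e ∈ S × ¬ Reach (S - e) (proj₁ (ends e)) (proj₂ (ends e))

unionAll : ∀ {m} → List (Subset m) → Subset m
unionAll = foldr _∪_ ⊥

-- Let e = uv be a cutedge of G⁺, X the component of u in G⁺ − e and Y the
-- component of v in G − δX.  Then δY ⊆ δX ⊆ {e} ∪ E⁻, both shores of δY are
-- connected (a vertex outside Y enters Y through an edge of δX, from X), so δY
-- is a bond, and 2-edge-connectivity puts a second, necessarily negative, edge f
-- in it.  Switching at δY cannot lower the number of negative edges, so δY has
-- no more negative than positive edges: δY = {e, f}.  Finally the cycle through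
-- f inside ⋃F has all degrees even, hence meets the cut δY evenly, so it uses e.

module Submission where

open import Defs
open import Data.Nat using (ℕ; zero; suc; _+_; _*_; _≤_; _<_; s≤s)
open import Data.Nat.Properties
  using (module ≤-Reasoning; +-*-semiring; *-commutativeSemigroup;
         +-identityʳ; *-identityʳ; *-zeroʳ; *-distribˡ-+; +-suc;
         ≤-trans; ≤-reflexive; <⇒≱; +-monoˡ-≤; +-monoʳ-≤; +-cancelˡ-≤; m≤m+n)
open import Data.Bool using (Bool; true; false; not; _∧_; _xor_; if_then_else_)
open import Data.Bool.Properties using (not-distribˡ-xor; xor-comm)
open import Data.Fin using (Fin; zero; suc; _≟_)
open import Data.Fin.Properties using (any?)
open import Data.Fin.Subset
open import Data.Fin.Subset.Properties
open import Data.Vec using ([]; _∷_; lookup; tabulate; here; there)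
open import Data.Vec.Properties using (lookup∘tabulate; lookup-zipWith; []=⇒lookup; lookup⇒[]=)
open import Data.List using (List; []; _∷_; map)
import Data.List as List
import Data.Nat.ListAction as ListAction
open import Data.List.Relation.Unary.All using (All)
import Data.List.Relation.Unary.Any as Any
open import Data.List.Membership.Propositional as L using ()
open import Data.Product using (∃-syntax; _×_; _,_; proj₁; proj₂)
open import Data.Sum using (_⊎_; inj₁; inj₂)
open import Function using (_∘_)
open import Relation.Nullary using (¬_; Dec; yes; no; does; contradiction)
open import Relation.Nullary.Decidable using (_×-dec_; _⊎-dec_; dec-true)
open import Relation.Unary using (Pred; Decidable)
open import Level using (0ℓ)
open import Relation.Binary.PropositionalEquality
open import Algebra.Properties.CommutativeSemigroup *-commutativeSemigroup using (x∙yz≈y∙xz)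
open import Algebra.Properties.Semiring.Sum +-*-semiring
  using (sum-syntax; sum-cong-≗; sum-replicate-zero; ∑-comm; ∑-distrib-+; *-distribˡ-sum)

𝟙 : Bool → ℕ
𝟙 true  = 1
𝟙 false = 0

parity : ℕ → Bool
parity zero    = false
parity (suc k) = not (parity k)

parity-+ : ∀ j k → parity (j + k) ≡ parity j xor parity k
parity-+ zero    k = refl
parity-+ (suc j) k = trans (cong not (parity-+ j k)) (not-distribˡ-xor (parity j) (parity k))

parity-𝟙* : ∀ b k → parity (𝟙 b * k) ≡ b ∧ parity k
parity-𝟙* true  k = cong parity (+-identityʳ k)
parity-𝟙* false k = refl

parity-𝟙 : ∀ b → parity (𝟙 b) ≡ b
parity-𝟙 true  = refl
parity-𝟙 false = refl

parity-𝟙+𝟙 : ∀ b c → parity (𝟙 b + 𝟙 c) ≡ b xor c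
parity-𝟙+𝟙 b c = trans (parity-+ (𝟙 b) (𝟙 c)) (cong₂ _xor_ (parity-𝟙 b) (parity-𝟙 c))

parity-∑-cong : ∀ {k} {f g : Fin k → ℕ} → (∀ i → parity (f i) ≡ parity (g i)) →
                parity (∑[ i < k ] f i) ≡ parity (∑[ i < k ] g i)
parity-∑-cong {zero}  eq = refl
parity-∑-cong {suc k} {f} {g} eq = begin
  parity (f zero + ∑[ i < k ] f (suc i))          ≡⟨ parity-+ (f zero) _ ⟩
  parity (f zero) xor parity (∑[ i < k ] f (suc i)) ≡⟨ cong₂ _xor_ (eq zero) (parity-∑-cong (eq ∘ suc)) ⟩
  parity (g zero) xor parity (∑[ i < k ] g (suc i)) ≡⟨ parity-+ (g zero) _ ⟨
  parity (g zero + ∑[ i < k ] g (suc i))          ∎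
  where open ≡-Reasoning

listSum-map-tabulate : ∀ {A : Set} k (f : Fin k → A) (h : A → ℕ) →
                       ListAction.sum (map h (List.tabulate f)) ≡ ∑[ i < k ] h (f i)
listSum-map-tabulate zero    f h = refl
listSum-map-tabulate (suc k) f h = cong (h (f zero) +_) (listSum-map-tabulate k (f ∘ suc) h)

∑-select : ∀ {k} (w : Fin k → ℕ) (x : Fin k) →
           ∑[ v < k ] (w v * (if does (x ≟ v) then 1 else 0)) ≡ w x
∑-select {suc k} w zero = trans
  (cong₂ _+_ (*-identityʳ (w zero)) (trans (sum-cong-≗ (λ v → *-zeroʳ (w (suc v)))) (sum-replicate-zero k)))
  (+-identityʳ (w zero))
∑-select {suc k} w (suc x) = cong₂ _+_ (*-zeroʳ (w zero)) (∑-select (w ∘ suc) x)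

if-then-0 : ∀ b k → (if b then k else 0) ≡ 𝟙 b * k
if-then-0 true  k = sym (+-identityʳ k)
if-then-0 false k = refl

∣p∣≡∑𝟙 : ∀ {k} (p : Subset k) → ∣ p ∣ ≡ ∑[ i < k ] 𝟙 (lookup p i)
∣p∣≡∑𝟙 []            = refl
∣p∣≡∑𝟙 (inside  ∷ p) = cong suc (∣p∣≡∑𝟙 p)
∣p∣≡∑𝟙 (outside ∷ p) = ∣p∣≡∑𝟙 p

lookup-∩ : ∀ {k} (p q : Subset k) i → lookup (p ∩ q) i ≡ lookup p i ∧ lookup q i
lookup-∩ p q i = lookup-zipWith _∧_ i p q

∉⇒lookup≡false : ∀ {k} {p : Subset k} {x} → x ∉ p → lookup p x ≡ false
∉⇒lookup≡false {p = p} {x} x∉p with lookup p x in eq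
... | true  = contradiction (lookup⇒[]= x p eq) x∉p
... | false = refl

decSubset : ∀ {k ℓ} {P : Pred (Fin k) ℓ} → Decidable P → Subset k
decSubset P? = tabulate (does ∘ P?)

module _ {k ℓ} {P : Pred (Fin k) ℓ} (P? : Decidable P) where

  ∈decSubset⁺ : ∀ {x} → P x → x ∈ decSubset P?
  ∈decSubset⁺ {x} px = lookup⇒[]= x _ (trans (lookup∘tabulate (does ∘ P?) x) (dec-true (P? x) px))

  ∈decSubset⁻ : ∀ {x} → x ∈ decSubset P? → P x
  ∈decSubset⁻ {x} x∈ with P? x | trans (sym (lookup∘tabulate (does ∘ P?) x)) ([]=⇒lookup x∈)
  ... | yes px | _ = px

x∈p─q⇒x∉q : ∀ {k} {p q : Subset k} {x} → x ∈ p ─ q → x ∉ q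
x∈p─q⇒x∉q {p = _ ∷ _} {outside ∷ _} here ()
x∈p─q⇒x∉q {p = _ ∷ _} {_ ∷ _} (there x∈) (there x∈q) = x∈p─q⇒x∉q x∈ x∈q

∣p∣≤1⇒x≡y : ∀ {k} {p : Subset k} {x y} → ∣ p ∣ ≤ 1 → x ∈ p → y ∈ p → x ≡ y
∣p∣≤1⇒x≡y {p = p} {x} {y} ∣p∣≤1 x∈p y∈p with x ≟ y
... | yes x≡y = x≡y
... | no  x≢y = contradiction ∣p∣≤1 (<⇒≱ (subst (_< ∣ p ∣) (∣⁅x⁆∣≡1 x) (p⊂q⇒∣p∣<∣q∣ ⁅x⁆⊂p)))
  where
  ⁅x⁆⊂p : ⁅ x ⁆ ⊂ p
  ⁅x⁆⊂p = (λ z∈ → subst (_∈ p) (sym (x∈⁅y⁆⇒x≡y x z∈)) x∈p) , y , y∈p , x≢y ∘ sym ∘ x∈⁅y⁆⇒x≡y x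

∈unionAll⁻ : ∀ {k} (F : List (Subset k)) {x} → x ∈ unionAll F → ∃[ C ] (C L.∈ F × x ∈ C)
∈unionAll⁻ []      x∈ = contradiction x∈ ∉⊥
∈unionAll⁻ (C ∷ F) x∈ with x∈p∪q⁻ C (unionAll F) x∈
... | inj₁ x∈C = C , Any.here refl , x∈C
... | inj₂ x∈⋃ with ∈unionAll⁻ F x∈⋃
...   | C′ , C′∈F , x∈C′ = C′ , Any.there C′∈F , x∈C′

even-∩⇒∈ : ∀ {k} {p q : Subset k} {e f} → parity ∣ p ∩ q ∣ ≡ false →
           f ∈ p → f ∈ q → (∀ {g} → g ∈ q → g ≡ e ⊎ g ≡ f) → e ∈ p
even-∩⇒∈ {p = p} {q} {e} {f} even f∈p f∈q q⊆ef with e ∈? p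
... | yes e∈p = e∈p
... | no  e∉p = contradiction (trans (sym (cong parity ∣p∩q∣≡1)) even) λ ()
  where
  p∩q⊆⁅f⁆ : p ∩ q ⊆ ⁅ f ⁆
  p∩q⊆⁅f⁆ {g} g∈ with x∈p∩q⁻ p q g∈
  ... | g∈p , g∈q with q⊆ef g∈q
  ...   | inj₁ refl = contradiction g∈p e∉p
  ...   | inj₂ refl = x∈⁅x⁆ f
  p∩q≡⁅f⁆ : p ∩ q ≡ ⁅ f ⁆
  p∩q≡⁅f⁆ = ⊆-antisym p∩q⊆⁅f⁆ λ g∈ → subst (_∈ p ∩ q) (sym (x∈⁅y⁆⇒x≡y f g∈)) (x∈p∩q⁺ (f∈p , f∈q))
  ∣p∩q∣≡1 : ∣ p ∩ q ∣ ≡ 1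
  ∣p∩q∣≡1 = trans (cong ∣_∣ p∩q≡⁅f⁆) (∣⁅x⁆∣≡1 f)

-- Components are computed as post-fixpoints of one-step expansion; k units of fuel
-- suffice because every proper expansion adds an element.

module _ {k ℓ} (f : Subset k → Subset k) (f-inflationary : ∀ {Q} → Q ⊆ f Q)
         (Inv : Subset k → Set ℓ) (f-preserves : ∀ {Q} → Inv Q → Inv (f Q)) where

  postfixpoint-above : ∀ Q → Inv Q → ∃[ R ] (Q ⊆ R × f R ⊆ R × Inv R)
  postfixpoint-above Q = go k Q (m≤m+n k ∣ Q ∣)
    where
    grow : ∀ fuel {Q} → Q ⊂ f Q → suc fuel + ∣ Q ∣ ≤ fuel + ∣ f Q ∣
    grow fuel {Q} Q⊂fQ = ≤-trans (≤-reflexive (sym (+-suc fuel ∣ Q ∣))) (+-monoʳ-≤ fuel (p⊂q⇒∣p∣<∣q∣ Q⊂fQ))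

    go : ∀ fuel Q → k ≤ fuel + ∣ Q ∣ → Inv Q → ∃[ R ] (Q ⊆ R × f R ⊆ R × Inv R)
    go fuel Q bound inv with Q ⊂? f Q
    ... | no Q⊄fQ = Q , (λ x∈ → x∈) , fQ⊆Q , inv
      where
      fQ⊆Q : f Q ⊆ Q
      fQ⊆Q {x} x∈fQ with x ∈? Q
      ... | yes x∈Q = x∈Q
      ... | no  x∉Q = contradiction ((λ {_} → f-inflationary) , x , x∈fQ , x∉Q) Q⊄fQ
    go zero Q bound inv | yes Q⊂fQ =
      contradiction (≤-trans (p⊂q⇒∣p∣<∣q∣ Q⊂fQ) (∣p∣≤n (f Q))) (<⇒≱ (s≤s bound))
    go (suc fuel) Q bound inv | yes Q⊂fQ with go fuel (f Q) (≤-trans bound (grow fuel Q⊂fQ)) (f-preserves inv)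
    ... | R , fQ⊆R , fR⊆R , invR = R , fQ⊆R ∘ f-inflationary , fR⊆R , invR

∈negSet : ∀ {k} {σ : Signature k} {g} → σ g ≡ minus → g ∈ negSet σ
∈negSet {σ = σ} {g} σg≡- = lookup⇒[]= g _ (trans (lookup∘tabulate (isNeg ∘ σ) g) (cong isNeg σg≡-))

∈posSet : ∀ {k} {σ : Signature k} {g} → σ g ≡ plus → g ∈ posSet σ
∈posSet {σ = σ} {g} σg≡+ = lookup⇒[]= g _ (trans (lookup∘tabulate (notNeg ∘ σ) g) (cong notNeg σg≡+))
  where
  notNeg : Sign → Bool
  notNeg s = if isNeg s then outside else inside

module _ {n m : ℕ} (G : Graph n m) where
  open Graph G

  end₁ end₂ : Fin m → Fin n
  end₁ g = proj₁ (ends g)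
  end₂ g = proj₂ (ends g)

  Joins-ends : ∀ g → Joins G g (end₁ g) (end₂ g)
  Joins-ends g = inj₁ (refl , refl)

  Joins-sym : ∀ {g x w} → Joins G g x w → Joins G g w x
  Joins-sym (inj₁ (p , q)) = inj₂ (p , q)
  Joins-sym (inj₂ (p , q)) = inj₁ (p , q)

  Joins? : ∀ g x w → Dec (Joins G g x w)
  Joins? g x w = (end₁ g ≟ x ×-dec end₂ g ≟ w) ⊎-dec (end₁ g ≟ w ×-dec end₂ g ≟ x)

  Reach-trans : ∀ {S x y z} → Reach G S x y → Reach G S y z → Reach G S x z
  Reach-trans here             r′ = r′
  Reach-trans (step g g∈ j r) r′ = step g g∈ j (Reach-trans r r′)

  Reach-sym : ∀ {S x y} → Reach G S x y → Reach G S y x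
  Reach-sym here            = here
  Reach-sym (step g g∈ j r) = Reach-trans (Reach-sym r) (step g g∈ (Joins-sym j) here)

  Reach-mono : ∀ {S T x y} → S ⊆ T → Reach G S x y → Reach G T x y
  Reach-mono S⊆T here            = here
  Reach-mono S⊆T (step g g∈ j r) = step g (S⊆T g∈) j (Reach-mono S⊆T r)

  -- Coboundaries

  δ : Subset n → Subset m
  δ Y = tabulate λ g → lookup Y (end₁ g) xor lookup Y (end₂ g)

  lookup-δ : ∀ {Y g x w} → Joins G g x w → lookup (δ Y) g ≡ lookup Y x xor lookup Y w
  lookup-δ {Y} {g} (inj₁ (refl , refl)) = lookup∘tabulate (λ g → lookup Y (end₁ g) xor lookup Y (end₂ g)) g
  lookup-δ {Y} {g} (inj₂ (refl , refl)) =
    trans (lookup∘tabulate (λ g → lookup Y (end₁ g) xor lookup Y (end₂ g)) g) (xor-comm (lookup Y (end₁ g)) _)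

  ∈δ⁺ : ∀ {Y g x w} → Joins G g x w → x ∈ Y → w ∉ Y → g ∈ δ Y
  ∈δ⁺ {Y} {g} j x∈ w∉ =
    lookup⇒[]= g (δ Y) (trans (lookup-δ {Y} j) (cong₂ _xor_ ([]=⇒lookup x∈) (∉⇒lookup≡false w∉)))

  ∈δ⇒∈ : ∀ {Y g x w} → g ∈ δ Y → Joins G g x w → x ∉ Y → w ∈ Y
  ∈δ⇒∈ {Y} {g} {x} {w} g∈ j x∉ = lookup⇒[]= w Y (begin
    lookup Y w                    ≡⟨ cong (_xor lookup Y w) (∉⇒lookup≡false x∉) ⟨
    lookup Y x xor lookup Y w     ≡⟨ lookup-δ {Y} j ⟨
    lookup (δ Y) g                ≡⟨ []=⇒lookup g∈ ⟩
    true                          ∎)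
    where open ≡-Reasoning

  ∈δ⇒∉ : ∀ {Y g x w} → g ∈ δ Y → Joins G g x w → x ∈ Y → w ∉ Y
  ∈δ⇒∉ {Y} {g} {x} {w} g∈ j x∈ w∈ = contradiction (begin
    false                         ≡⟨⟩
    true xor true                 ≡⟨ cong₂ _xor_ ([]=⇒lookup x∈) ([]=⇒lookup w∈) ⟨
    lookup Y x xor lookup Y w     ≡⟨ lookup-δ {Y} j ⟨
    lookup (δ Y) g                ≡⟨ []=⇒lookup g∈ ⟩
    true                          ∎) λ ()
    where open ≡-Reasoning

  Reach⇒∈ : ∀ {S Y x w} → (∀ {g} → g ∈ S → g ∉ δ Y) → Reach G S x w → x ∈ Y → w ∈ Y
  Reach⇒∈ S∩δ=∅ here            x∈ = x∈
  Reach⇒∈ {Y = Y} S∩δ=∅ (step {w = x′} g g∈ j r) x∈ with x′ ∈? Y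
  ... | yes x′∈ = Reach⇒∈ S∩δ=∅ r x′∈
  ... | no  x′∉ = contradiction (∈δ⁺ j x∈ x′∉) (S∩δ=∅ g∈)

  first-entry : ∀ {S Y x y} → Reach G S x y → x ∉ Y → y ∈ Y →
    ∃[ z ] ∃[ w ] ∃[ g ] (Reach G (S ─ δ Y) x z × g ∈ S × Joins G g z w × z ∉ Y × w ∈ Y)
  first-entry here x∉ y∈ = contradiction y∈ x∉
  first-entry {Y = Y} {x} (step {w = x′} g g∈ j r) x∉ y∈ with x′ ∈? Y
  ... | yes x′∈ = x , x′ , g , here , g∈ , j , x∉ , x′∈
  ... | no  x′∉ with first-entry r x′∉ y∈
  ...   | z , w , g′ , r′ , rest =
    z , w , g′ , step g (x∈p∧x∉q⇒x∈p─q g∈ λ g∈δ → x′∉ (∈δ⇒∈ g∈δ j x∉)) j r′ , rest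


  Neighbour : Subset m → Subset n → Pred (Fin n) 0ℓ
  Neighbour S Q w = ∃[ g ] (g ∈ S × ∃[ x ] (x ∈ Q × Joins G g x w))

  Neighbour? : ∀ S Q → Decidable (Neighbour S Q)
  Neighbour? S Q w = any? λ g → g ∈? S ×-dec any? λ x → x ∈? Q ×-dec Joins? g x w

  expand : Subset m → Subset n → Subset n
  expand S Q = Q ∪ decSubset (Neighbour? S Q)

  ReachableFrom : Subset m → Fin n → Subset n → Set
  ReachableFrom S s Q = ∀ {t} → t ∈ Q → Reach G S s t

  expand-reachable : ∀ {S s Q} → ReachableFrom S s Q → ReachableFrom S s (expand S Q)
  expand-reachable {S} {s} {Q} reach t∈ with x∈p∪q⁻ Q _ t∈
  ... | inj₁ t∈Q = reach t∈Q
  ... | inj₂ t∈N with ∈decSubset⁻ (Neighbour? S Q) t∈N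
  ...   | g , g∈ , x , x∈ , j = Reach-trans (reach x∈) (step g g∈ j here)

  opaque
    component-spec : ∀ S s → ∃[ C ] (⁅ s ⁆ ⊆ C × expand S C ⊆ C × ReachableFrom S s C)
    component-spec S s = postfixpoint-above (expand S) (p⊆p∪q _) (ReachableFrom S s) expand-reachable
      ⁅ s ⁆ λ t∈ → subst (Reach G S s) (sym (x∈⁅y⁆⇒x≡y s t∈)) here

  component : Subset m → Fin n → Subset n
  component S s = proj₁ (component-spec S s)

  ∈component⇒Reach : ∀ {S s t} → t ∈ component S s → Reach G S s t
  ∈component⇒Reach {S} {s} = proj₂ (proj₂ (proj₂ (component-spec S s)))

  component-step : ∀ {S s g x w} → g ∈ S → Joins G g x w → x ∈ component S s → w ∈ component S s
  component-step {S} {s} g∈ j x∈ =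
    proj₁ (proj₂ (proj₂ (component-spec S s)))
      (x∈p∪q⁺ (inj₂ (∈decSubset⁺ (Neighbour? S _) (_ , g∈ , _ , x∈ , j))))

  Reach⇒∈component : ∀ {S s t} → Reach G S s t → t ∈ component S s
  Reach⇒∈component {S} {s} = go (proj₁ (proj₂ (component-spec S s)) (x∈⁅x⁆ s))
    where
    go : ∀ {x t} → x ∈ component S s → Reach G S x t → t ∈ component S s
    go x∈ here            = x∈
    go x∈ (step g g∈ j r) = go (component-step g∈ j x∈) r

  component-δ-free : ∀ {S s g} → g ∈ S → g ∉ δ (component S s)
  component-δ-free {S} {s} {g} g∈S g∈δ with end₁ g ∈? component S s
  ... | yes e₁∈ = ∈δ⇒∉ g∈δ (Joins-ends g) e₁∈ (component-step g∈S (Joins-ends g) e₁∈)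
  ... | no  e₁∉ = e₁∉ (component-step g∈S (Joins-sym (Joins-ends g)) (∈δ⇒∈ g∈δ (Joins-ends g) e₁∉))

  -- Bonds

  connected-shores⇒IsEdgeCut : ∀ {Y y z} → y ∈ Y → z ∉ Y →
    (∀ {x} → x ∈ Y → Reach G (⊤ ─ δ Y) x y) → (∀ {x} → x ∉ Y → Reach G (⊤ ─ δ Y) x z) →
    IsEdgeCut G (δ Y)
  connected-shores⇒IsEdgeCut {Y} {y} {z} y∈ z∉ inner outer = disconnected , minimal
    where
    disconnected : ¬ SpanConnected G (⊤ ─ δ Y)
    disconnected connected = z∉ (Reach⇒∈ x∈p─q⇒x∉q (connected y z) y∈)

    minimal : ∀ T → T ⊂ δ Y → SpanConnected G (⊤ ─ T)
    minimal T (T⊆δ , h , h∈δ , h∉T) x x′ = Reach-trans (to-y x) (Reach-sym (to-y x′))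
      where
      widen : ∀ {x w} → Reach G (⊤ ─ δ Y) x w → Reach G (⊤ ─ T) x w
      widen = Reach-mono λ g∈ → x∈p∧x∉q⇒x∈p─q ∈⊤ (x∈p─q⇒x∉q g∈ ∘ T⊆δ)

      h∈ : h ∈ ⊤ ─ T
      h∈ = x∈p∧x∉q⇒x∈p─q ∈⊤ h∉T

      z↝y : Reach G (⊤ ─ T) z y
      z↝y with end₁ h ∈? Y
      ... | yes e₁∈ = Reach-trans (Reach-sym (widen (outer (∈δ⇒∉ h∈δ (Joins-ends h) e₁∈))))
                                  (step h h∈ (Joins-sym (Joins-ends h)) (widen (inner e₁∈)))
      ... | no  e₁∉ = Reach-trans (Reach-sym (widen (outer e₁∉)))
                                  (step h h∈ (Joins-ends h) (widen (inner (∈δ⇒∈ h∈δ (Joins-ends h) e₁∉))))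

      to-y : ∀ x → Reach G (⊤ ─ T) x y
      to-y x with x ∈? Y
      ... | yes x∈ = widen (inner x∈)
      ... | no  x∉ = Reach-trans (widen (outer x∉)) z↝y

  bridgeless⇒δ-edge-other-than : (∀ e → SpanConnected G (⊤ - e)) →
    ∀ {Y x y} e → x ∉ Y → y ∈ Y → ∃[ f ] (f ∈ δ Y × f ≢ e)
  bridgeless⇒δ-edge-other-than bridgeless {x = x} {y} e x∉ y∈ with first-entry (bridgeless e x y) x∉ y∈
  ... | z , w , f , _ , f∈ , j , z∉ , w∈ = f , ∈δ⁺ (Joins-sym j) w∈ z∉ , x∉⁅y⁆⇒x≢y (x∈p─q⇒x∉q f∈)

  bridgeless⇒second-edge : (∀ e → SpanConnected G (⊤ - e)) →
    ∀ {Y e} → e ∈ δ Y → ∃[ f ] (f ∈ δ Y × f ≢ e)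
  bridgeless⇒second-edge bridgeless {Y} {e} e∈δ with end₁ e ∈? Y
  ... | yes e₁∈ = bridgeless⇒δ-edge-other-than bridgeless e (∈δ⇒∉ e∈δ (Joins-ends e) e₁∈) e₁∈
  ... | no  e₁∉ = bridgeless⇒δ-edge-other-than bridgeless e e₁∉ (∈δ⇒∈ e∈δ (Joins-ends e) e₁∉)

  cutedge⇒bond : SpanConnected G ⊤ → ∀ P {e} → IsCutedgeOf G P e →
    ∃[ Y ] (IsEdgeCut G (δ Y) × e ∈ δ Y × (∀ {g} → g ∈ δ Y → g ∈ P → g ≡ e))
  cutedge⇒bond connected P {e} (_ , e-cut) = Y , bond , e∈δY , δY∩P⊆e
    where
    u v : Fin n
    u = end₁ e
    v = end₂ e

    X Y : Subset n
    X = component (P - e) u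
    Y = component (⊤ ─ δ X) v

    δX-free : ∀ {g} → g ∈ P - e → g ∉ δ X
    δX-free = component-δ-free

    δY⊆δX : δ Y ⊆ δ X
    δY⊆δX {g} g∈δY with g ∈? δ X
    ... | yes g∈δX = g∈δX
    ... | no  g∉δX = contradiction g∈δY (component-δ-free (x∈p∧x∉q⇒x∈p─q ∈⊤ g∉δX))

    avoids-δY : ∀ {S} → (∀ {g} → g ∈ S → g ∉ δ X) → S ⊆ ⊤ ─ δ Y
    avoids-δY S-free g∈S = x∈p∧x∉q⇒x∈p─q ∈⊤ (S-free g∈S ∘ δY⊆δX)

    u∈X : u ∈ X
    u∈X = Reach⇒∈component here

    v∈Y : v ∈ Y
    v∈Y = Reach⇒∈component here

    Y∩X≡∅ : ∀ {t} → t ∈ Y → t ∉ X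
    Y∩X≡∅ t∈Y t∈X = e-cut (∈component⇒Reach (Reach⇒∈ x∈p─q⇒x∉q (Reach-sym (∈component⇒Reach t∈Y)) t∈X))

    u∉Y : u ∉ Y
    u∉Y u∈Y = Y∩X≡∅ u∈Y u∈X

    e∈δY : e ∈ δ Y
    e∈δY = ∈δ⁺ (Joins-sym (Joins-ends e)) v∈Y u∉Y

    δY∩P⊆e : ∀ {g} → g ∈ δ Y → g ∈ P → g ≡ e
    δY∩P⊆e {g} g∈δY g∈P with g ≟ e
    ... | yes g≡e = g≡e
    ... | no  g≢e = contradiction (δY⊆δX g∈δY) (δX-free (x∈p∧x≢y⇒x∈p-y g∈P g≢e))

    inner : ∀ {x} → x ∈ Y → Reach G (⊤ ─ δ Y) x v
    inner x∈ = Reach-sym (Reach-mono (avoids-δY x∈p─q⇒x∉q) (∈component⇒Reach x∈))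

    outer : ∀ {x} → x ∉ Y → Reach G (⊤ ─ δ Y) x u
    outer {x} x∉ with first-entry (connected x v) x∉ v∈Y
    ... | z , w , g , x↝z , _ , j , z∉Y , w∈Y =
      Reach-trans x↝z (Reach-sym (Reach-mono (avoids-δY δX-free) (∈component⇒Reach z∈X)))
      where
      z∈X : z ∈ X
      z∈X with z ∈? X
      ... | yes z∈ = z∈
      ... | no  z∉ = contradiction (∈δ⇒∈ (δY⊆δX (∈δ⁺ (Joins-sym j) w∈Y z∉Y)) j z∉) (Y∩X≡∅ w∈Y)

    bond : IsEdgeCut G (δ Y)
    bond = connected-shores⇒IsEdgeCut v∈Y u∉Y inner outer

  -- Degrees and switching

  incidence : Fin m → Fin n → ℕ
  incidence g v = ind G (end₁ g) v + ind G (end₂ g) v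

  deg≡∑ : ∀ D v → deg G D v ≡ ∑[ g < m ] (𝟙 (lookup D g) * incidence g v)
  deg≡∑ D v = trans (listSum-map-tabulate m (λ g → g) _) (sum-cong-≗ λ g → if-then-0 (lookup D g) _)

  ∑-incidence : ∀ (w : Fin n → ℕ) g → ∑[ v < n ] (w v * incidence g v) ≡ w (end₁ g) + w (end₂ g)
  ∑-incidence w g = begin
    ∑[ v < n ] (w v * incidence g v)
      ≡⟨ sum-cong-≗ (λ v → *-distribˡ-+ (w v) (ind G (end₁ g) v) _) ⟩
    ∑[ v < n ] (w v * ind G (end₁ g) v + w v * ind G (end₂ g) v)
      ≡⟨ ∑-distrib-+ (λ v → w v * ind G (end₁ g) v) (λ v → w v * ind G (end₂ g) v) ⟩
    ∑[ v < n ] (w v * ind G (end₁ g) v) + ∑[ v < n ] (w v * ind G (end₂ g) v)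
      ≡⟨ cong₂ _+_ (∑-select w (end₁ g)) (∑-select w (end₂ g)) ⟩
    w (end₁ g) + w (end₂ g) ∎
    where open ≡-Reasoning

  ∑-shore-deg : ∀ Y D → ∑[ v < n ] (𝟙 (lookup Y v) * deg G D v)
                      ≡ ∑[ g < m ] (𝟙 (lookup D g) * (𝟙 (lookup Y (end₁ g)) + 𝟙 (lookup Y (end₂ g))))
  ∑-shore-deg Y D = begin
    ∑[ v < n ] (y v * deg G D v)
      ≡⟨ sum-cong-≗ (λ v → cong (y v *_) (deg≡∑ D v)) ⟩
    ∑[ v < n ] (y v * ∑[ g < m ] (d g * incidence g v))
      ≡⟨ sum-cong-≗ (λ v → *-distribˡ-sum (y v) λ g → d g * incidence g v) ⟩
    ∑[ v < n ] ∑[ g < m ] (y v * (d g * incidence g v))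
      ≡⟨ ∑-comm (λ v g → y v * (d g * incidence g v)) ⟩
    ∑[ g < m ] ∑[ v < n ] (y v * (d g * incidence g v))
      ≡⟨ sum-cong-≗ (λ g → sum-cong-≗ λ v → x∙yz≈y∙xz (y v) (d g) _) ⟩
    ∑[ g < m ] ∑[ v < n ] (d g * (y v * incidence g v))
      ≡⟨ sum-cong-≗ (λ g → *-distribˡ-sum (d g) λ v → y v * incidence g v) ⟨
    ∑[ g < m ] (d g * ∑[ v < n ] (y v * incidence g v))
      ≡⟨ sum-cong-≗ (λ g → cong (d g *_) (∑-incidence y g)) ⟩
    ∑[ g < m ] (d g * (y (end₁ g) + y (end₂ g))) ∎
    where
    open ≡-Reasoning
    y : Fin n → ℕ
    y = 𝟙 ∘ lookup Y
    d : Fin m → ℕ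
    d = 𝟙 ∘ lookup D

  even-degrees⇒even-δ : ∀ {Y D} → (∀ {v} → v ∈ Y → parity (deg G D v) ≡ false) → parity ∣ D ∩ δ Y ∣ ≡ false
  even-degrees⇒even-δ {Y} {D} even = begin
    parity ∣ D ∩ δ Y ∣                                      ≡⟨ cong parity (∣p∣≡∑𝟙 (D ∩ δ Y)) ⟩
    parity (∑[ g < m ] 𝟙 (lookup (D ∩ δ Y) g))              ≡⟨ parity-∑-cong per-edge ⟩
    parity (∑[ g < m ] (𝟙 (lookup D g) * (𝟙 (lookup Y (end₁ g)) + 𝟙 (lookup Y (end₂ g)))))
                                                            ≡⟨ cong parity (∑-shore-deg Y D) ⟨
    parity (∑[ v < n ] (𝟙 (lookup Y v) * deg G D v))        ≡⟨ parity-∑-cong per-vertex ⟩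
    parity (∑[ v < n ] 0)                                   ≡⟨ cong parity (sum-replicate-zero n) ⟩
    false                                                   ∎
    where
    open ≡-Reasoning
    per-edge : ∀ g → parity (𝟙 (lookup (D ∩ δ Y) g))
                   ≡ parity (𝟙 (lookup D g) * (𝟙 (lookup Y (end₁ g)) + 𝟙 (lookup Y (end₂ g))))
    per-edge g = begin
      parity (𝟙 (lookup (D ∩ δ Y) g))
        ≡⟨ parity-𝟙 (lookup (D ∩ δ Y) g) ⟩
      lookup (D ∩ δ Y) g
        ≡⟨ lookup-∩ D (δ Y) g ⟩
      lookup D g ∧ lookup (δ Y) g
        ≡⟨ cong (lookup D g ∧_) (lookup-δ {Y} (Joins-ends g)) ⟩
      lookup D g ∧ (lookup Y (end₁ g) xor lookup Y (end₂ g))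
        ≡⟨ cong (lookup D g ∧_) (parity-𝟙+𝟙 (lookup Y (end₁ g)) (lookup Y (end₂ g))) ⟨
      lookup D g ∧ parity (𝟙 (lookup Y (end₁ g)) + 𝟙 (lookup Y (end₂ g)))
        ≡⟨ parity-𝟙* (lookup D g) _ ⟨
      parity (𝟙 (lookup D g) * (𝟙 (lookup Y (end₁ g)) + 𝟙 (lookup Y (end₂ g)))) ∎

    per-vertex : ∀ v → parity (𝟙 (lookup Y v) * deg G D v) ≡ parity 0
    per-vertex v with lookup Y v in v∈Y
    ... | true  = trans (parity-𝟙* true (deg G D v)) (even (lookup⇒[]= v Y v∈Y))
    ... | false = refl

  IsCycle⇒even-degree : ∀ {D} → IsCycle G D → ∀ v → parity (deg G D v) ≡ false
  IsCycle⇒even-degree (_ , _ , two-regular) v with two-regular v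
  ... | inj₁ deg≡0 = cong parity deg≡0
  ... | inj₂ deg≡2 = cong parity deg≡2

  ∣negSet-switch∣ : ∀ σ S → ∣ negSet (switch G σ S) ∣ + ∣ S ∩ negSet σ ∣ ≡ ∣ negSet σ ∣ + ∣ S ∩ posSet σ ∣
  ∣negSet-switch∣ σ S = begin
    ∣ negSet τ ∣ + ∣ S ∩ negSet σ ∣
      ≡⟨ cong₂ _+_ (∣p∣≡∑𝟙 (negSet τ)) (∣p∣≡∑𝟙 (S ∩ negSet σ)) ⟩
    ∑[ g < m ] 𝟙 (lookup (negSet τ) g) + ∑[ g < m ] 𝟙 (lookup (S ∩ negSet σ) g)
      ≡⟨ ∑-distrib-+ (λ g → 𝟙 (lookup (negSet τ) g)) (λ g → 𝟙 (lookup (S ∩ negSet σ) g)) ⟨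
    ∑[ g < m ] (𝟙 (lookup (negSet τ) g) + 𝟙 (lookup (S ∩ negSet σ) g))
      ≡⟨ sum-cong-≗ per-edge ⟩
    ∑[ g < m ] (𝟙 (lookup (negSet σ) g) + 𝟙 (lookup (S ∩ posSet σ) g))
      ≡⟨ ∑-distrib-+ (λ g → 𝟙 (lookup (negSet σ) g)) (λ g → 𝟙 (lookup (S ∩ posSet σ) g)) ⟩
    ∑[ g < m ] 𝟙 (lookup (negSet σ) g) + ∑[ g < m ] 𝟙 (lookup (S ∩ posSet σ) g)
      ≡⟨ cong₂ _+_ (∣p∣≡∑𝟙 (negSet σ)) (∣p∣≡∑𝟙 (S ∩ posSet σ)) ⟨
    ∣ negSet σ ∣ + ∣ S ∩ posSet σ ∣ ∎
    where
    open ≡-Reasoning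
    τ = switch G σ S
    flip-count : ∀ s σg → 𝟙 (isNeg (if s then flipSign σg else σg)) + 𝟙 (s ∧ isNeg σg)
                        ≡ 𝟙 (isNeg σg) + 𝟙 (s ∧ (if isNeg σg then outside else inside))
    flip-count true  plus  = refl
    flip-count true  minus = refl
    flip-count false plus  = refl
    flip-count false minus = refl
    per-edge : ∀ g → 𝟙 (lookup (negSet τ) g) + 𝟙 (lookup (S ∩ negSet σ) g)
                   ≡ 𝟙 (lookup (negSet σ) g) + 𝟙 (lookup (S ∩ posSet σ) g)
    per-edge g
      rewrite lookup∘tabulate (isNeg ∘ τ) g | lookup-∩ S (negSet σ) g | lookup-∩ S (posSet σ) g
            | lookup∘tabulate (isNeg ∘ σ) g
            | lookup∘tabulate (λ e → if isNeg (σ e) then outside else inside) g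
      = flip-count (lookup S g) (σ g)

  MinNegative⇒∣S∩neg∣≤∣S∩pos∣ : ∀ {σ S} → MinNegative G σ → IsEdgeCut G S →
                                ∣ S ∩ negSet σ ∣ ≤ ∣ S ∩ posSet σ ∣
  MinNegative⇒∣S∩neg∣≤∣S∩pos∣ {σ} {S} minimal cut = +-cancelˡ-≤ ∣ negSet σ ∣ _ _ (begin
    ∣ negSet σ ∣ + ∣ S ∩ negSet σ ∣
      ≤⟨ +-monoˡ-≤ _ (minimal _ (switchAt S cut (same λ _ → refl))) ⟩
    ∣ negSet (switch G σ S) ∣ + ∣ S ∩ negSet σ ∣
      ≡⟨ ∣negSet-switch∣ σ S ⟩
    ∣ negSet σ ∣ + ∣ S ∩ posSet σ ∣ ∎)
    where open ≤-Reasoning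

  MinNegative⇒bond-with-one-positive : ∀ {σ S e f} → MinNegative G σ → IsEdgeCut G S →
    (∀ {g} → g ∈ S → g ∈ posSet σ → g ≡ e) → f ∈ S → f ≢ e →
    σ f ≡ minus × (∀ {g} → g ∈ S → g ≡ e ⊎ g ≡ f)
  MinNegative⇒bond-with-one-positive {σ} {S} {e} {f} minimal cut S∩P⊆e f∈S f≢e = negative f∈S f≢e , S⊆ef
    where
    negative : ∀ {g} → g ∈ S → g ≢ e → σ g ≡ minus
    negative {g} g∈S g≢e with σ g in σg
    ... | plus  = contradiction (S∩P⊆e g∈S (∈posSet σg)) g≢e
    ... | minus = refl

    ∣S∩pos∣≤1 : ∣ S ∩ posSet σ ∣ ≤ 1
    ∣S∩pos∣≤1 = ≤-trans (p⊆q⇒∣p∣≤∣q∣ S∩P⊆⁅e⁆) (≤-reflexive (∣⁅x⁆∣≡1 e))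
      where
      S∩P⊆⁅e⁆ : S ∩ posSet σ ⊆ ⁅ e ⁆
      S∩P⊆⁅e⁆ g∈ with x∈p∩q⁻ S (posSet σ) g∈
      ... | g∈S , g∈P = subst (_∈ ⁅ e ⁆) (sym (S∩P⊆e g∈S g∈P)) (x∈⁅x⁆ e)

    S⊆ef : ∀ {g} → g ∈ S → g ≡ e ⊎ g ≡ f
    S⊆ef {g} g∈S with g ≟ e
    ... | yes g≡e = inj₁ g≡e
    ... | no  g≢e = inj₂ (∣p∣≤1⇒x≡y (≤-trans (MinNegative⇒∣S∩neg∣≤∣S∩pos∣ minimal cut) ∣S∩pos∣≤1)
                                   (x∈p∩q⁺ (g∈S , ∈negSet (negative g∈S g≢e)))
                                   (x∈p∩q⁺ (f∈S , ∈negSet (negative f∈S f≢e))))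

lemma3p1 : ∀ {n m : ℕ} (G : Graph n m) (σ : Signature m) →
    TwoEdgeConnected G →
    MinNegative G σ →
    (F : List (Subset m)) →
    All (IsCircuit G σ) F →
    (∀ e → σ e ≡ minus → ∃[ D ] (D ⊆ unionAll F × IsCycle G D × e ∈ D)) →
    ∀ e → IsCutedgeOf G (posSet σ) e → ∃[ C ] (C L.∈ F × e ∈ C)
lemma3p1 G σ (connected , bridgeless) minimal F _ negative-in-cycle e e-cutedge with
  cutedge⇒bond G connected (posSet σ) e-cutedge
... | Y , bond , e∈δY , δY∩pos⊆e with bridgeless⇒second-edge G bridgeless {Y} e∈δY
...   | f , f∈δY , f≢e with MinNegative⇒bond-with-one-positive G minimal bond δY∩pos⊆e f∈δY f≢e
...     | σf≡- , δY⊆ef with negative-in-cycle f σf≡-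
...       | D , D⊆⋃F , D-cycle , f∈D =
  ∈unionAll⁻ F (D⊆⋃F (even-∩⇒∈ D∩δY-even f∈D f∈δY δY⊆ef))
  where
  D∩δY-even : parity ∣ D ∩ δ G Y ∣ ≡ false
  D∩δY-even = even-degrees⇒even-δ G {Y} {D} λ {v} _ → IsCycle⇒even-degree G D-cycle v
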